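{- For arbitrary integers $p, q, r$ with $0 < p \le q \le r \le 2q$, there exists a finite simple connected graph $G$ with $\operatorname{ind-match}(G) = p$, $\operatorname{min-match}(G) = q$, and $\operatorname{match}(G) = r$.
   Context: A matching of $G$ is a set of pairwise disjoint edges; a maximal matching is one not properly contained in another matching. $\operatorname{match}(G)$ is the maximum cardinality of a matching and $\operatorname{min-match}(G)$ the minimum cardinality of a maximal matching. Two edges $e, e'$ are $3$-disjoint if $e \cap e' = \emptyset$ and no edge $f$ meets both; an induced matching is a set of pairwise $3$-disjoint edges, and $\operatorname{ind-match}(G)$ is the maximum cardinality of an induced matching. -}

module Defs where

open import Data.Nat using (ℕ; _≤_; _<_)
open import Data.Fin using (Fin)
open import Data.Bool using (Bool; true)
open import Data.Product using (Σ; _×_; _,_; ∃)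
open import Data.Sum using (_⊎_)
open import Data.List using (List; length)
open import Data.List.Relation.Unary.All using (All)
open import Data.List.Relation.Unary.Any using (Any)
open import Data.List.Relation.Unary.AllPairs using (AllPairs)
open import Relation.Binary.PropositionalEquality using (_≡_; _≢_)
open import Relation.Nullary using (¬_)

record Graph : Set where
  field
    n      : ℕ
    adj    : Fin n → Fin n → Bool
    sym    : ∀ u v → adj u v ≡ adj v u
    irrefl : ∀ u → ¬ (adj u u ≡ true)

module _ (G : Graph) where
  open Graph G

  -- an (unordered) edge {u,v} is represented by an ordered pair (u , v)
  Pair : Set
  Pair = Fin n × Fin n

  IsEdge : Pair → Set
  IsEdge (u , v) = adj u v ≡ true

  SameEdge : Pair → Pair → Set
  SameEdge (a , b) (c , d) = (a ≡ c × b ≡ d) ⊎ (a ≡ d × b ≡ c)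

  _∈E_ : Pair → List Pair → Set
  e ∈E M = Any (SameEdge e) M

  Disjoint : Pair → Pair → Set
  Disjoint (a , b) (c , d) = a ≢ c × a ≢ d × b ≢ c × b ≢ d

  Meets : Pair → Pair → Set
  Meets (x , y) (a , b) = (x ≡ a ⊎ x ≡ b) ⊎ (y ≡ a ⊎ y ≡ b)

  ThreeDisjoint : Pair → Pair → Set
  ThreeDisjoint e e' = Disjoint e e' × (∀ f → IsEdge f → ¬ (Meets f e × Meets f e'))

  -- a matching: a set of pairwise disjoint edges (pairwise disjointness
  -- also makes the listed edges distinct, so length = cardinality)
  IsMatching : List Pair → Set
  IsMatching M = All IsEdge M × AllPairs Disjoint M

  IsMaximalMatching : List Pair → Set
  IsMaximalMatching M =
    IsMatching M ×
    (∀ M' → IsMatching M' → (∀ e → e ∈E M → e ∈E M') → ∀ e → e ∈E M' → e ∈E M)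

  IsInducedMatching : List Pair → Set
  IsInducedMatching M = All IsEdge M × AllPairs ThreeDisjoint M

  MatchNumber : ℕ → Set
  MatchNumber r =
    Σ (List Pair) (λ M → IsMatching M × length M ≡ r) ×
    (∀ M → IsMatching M → length M ≤ r)

  MinMatchNumber : ℕ → Set
  MinMatchNumber q =
    Σ (List Pair) (λ M → IsMaximalMatching M × length M ≡ q) ×
    (∀ M → IsMaximalMatching M → q ≤ length M)

  IndMatchNumber : ℕ → Set
  IndMatchNumber p =
    Σ (List Pair) (λ M → IsInducedMatching M × length M ≡ p) ×
    (∀ M → IsInducedMatching M → length M ≤ p)

  data Walk : Fin n → Fin n → Set where
    here : ∀ {u} → Walk u u
    step : ∀ {u v w} → adj u v ≡ true → Walk v w → Walk u w

  Connected : Set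
  Connected = (0 < n) × (∀ u v → Walk u v)

module Submission where

-- Join a hub
-- to a clique on 2(A+H) vertices, to S spokes and to D arms (paths hub–x–y), and
-- hang a pendant leaf on 2A of the clique vertices, on every spoke and on both
-- vertices of every arm. The clique, each spoke and each arm are cliques covering
-- every edge, so an induced matching has at most 1 + S + D edges, and one clique
-- edge with the spoke leaves and the arm edges attains this. A maximal matching
-- saturates every vertex carrying a leaf, all but at most one clique vertex, and
-- every spoke together with a partner lying outside the clique, the spokes and
-- the arms; this forces A + H + S + D edges, attained by pairing up the clique and
-- the arms and matching each spoke with its leaf. The graph has 2(2A + H + S + 2D) + 1
-- vertices, and matching every leaf with its owner plus H clique edges is perfect
-- up to one vertex. For p = k + 1 and r = q + a take A = 0, D = a, S = k − a if
-- a ≤ k, and S = 0, D = k, A = a − k otherwise; H adjusts q.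

open import Defs
open import Data.Bool using (Bool; true; false; _∨_; not)
open import Data.Empty using (⊥; ⊥-elim)
open import Data.Fin using (Fin; zero; suc)
open import Data.Fin.Properties using (_≟_; injective⇒≤; +↔⊎; *↔×; 1↔⊤; 2↔Bool)
open import Data.List using (List; _∷_; length; lookup; tabulate)
open import Data.List.Properties using (length-tabulate)
open import Data.List.Membership.Propositional using (find; lose)
open import Data.List.Membership.Propositional.Properties using (∈-lookup)
open import Data.List.Relation.Unary.All as All using (All; []; _∷_)
open import Data.List.Relation.Unary.All.Properties using (¬Any⇒All¬)
import Data.List.Relation.Unary.All.Properties as All
open import Data.List.Relation.Unary.AllPairs using (AllPairs; []; _∷_)
import Data.List.Relation.Unary.AllPairs.Properties as AllPairs
open import Data.List.Relation.Unary.Any as Any using (Any; here; there; any?)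
open import Data.List.Relation.Unary.Any.Properties using (lookup-index)
import Data.List.Relation.Unary.Any.Properties as Any
open import Data.Maybe using (Maybe; just; nothing)
open import Data.Maybe.Properties using (just-injective)
open import Data.Nat using (ℕ; suc; _+_; _*_; _≤_; _<_; s≤s; z≤n; _≤?_)
open import Data.Nat.Properties using (⌊n/2⌋-mono; n≡⌊n+n/2⌋; n≡⌈n+n/2⌉; +-cancelˡ-≤; +-identityʳ; m≤n⇒∃[o]m+o≡n; ≰⇒>)
open import Data.Nat.Tactic.RingSolver using (solve-∀)
open import Data.Product using (Σ; ∃-syntax; _×_; _,_; proj₁; proj₂)
open import Data.Sum as ⊎ using (_⊎_; inj₁; inj₂; [_,_]; swap; reduce)
open import Data.Sum.Function.Propositional using (_⊎-↔_)
open import Data.Sum.Properties using (swap-↔)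
import Data.Sum.Properties as ⊎ₚ
import Data.Product.Properties as ×
import Data.Unit.Properties as ⊤
import Data.Bool.Properties as 𝔹
open import Data.Product.Function.NonDependent.Propositional using (_×-↔_)
open import Data.Unit using (⊤; tt)
open import Function using (_∘_; id)
open import Function.Bundles using (_↔_; Inverse; Injection; mk↔ₛ′)
open import Function.Definitions using (Injective)
open import Function.Construct.Composition using (_↔-∘_)
open import Function.Properties.Inverse using (↔-refl; ↔-sym; ↔⇒↣)
open import Relation.Binary.Definitions using (Symmetric; DecidableEquality)
open import Relation.Binary.PropositionalEquality using (_≡_; _≢_; refl; sym; trans; cong; subst; subst₂; module ≡-Reasoning)
open import Relation.Nullary using (¬_; Dec; yes; no; does)
open import Relation.Nullary.Decidable using (_⊎-dec_; dec-true; dec-false)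

AllPairs-lookup : ∀ {A : Set} {R : A → A → Set} {xs : List A} → Symmetric R → AllPairs R xs →
                  ∀ {i j} → i ≢ j → R (lookup xs i) (lookup xs j)
AllPairs-lookup R-sym (r ∷ _)  {zero}  {zero}  i≢j = ⊥-elim (i≢j refl)
AllPairs-lookup R-sym (r ∷ _)  {zero}  {suc j} _   = All.lookup r (∈-lookup j)
AllPairs-lookup R-sym (r ∷ _)  {suc i} {zero}  _   = R-sym (All.lookup r (∈-lookup i))
AllPairs-lookup R-sym (_ ∷ rs) {suc i} {suc j} i≢j = AllPairs-lookup R-sym rs (i≢j ∘ cong suc)

⊎-↔Fin : ∀ {A B : Set} {a b} → A ↔ Fin a → B ↔ Fin b → (A ⊎ B) ↔ Fin (a + b)
⊎-↔Fin A↔ B↔ = ↔-sym +↔⊎ ↔-∘ (A↔ ⊎-↔ B↔)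

Maybe-↔Fin : ∀ {A : Set} {a} → A ↔ Fin a → Maybe A ↔ Fin (suc a)
Maybe-↔Fin A↔ = ⊎-↔Fin (↔-sym 1↔⊤) A↔ ↔-∘ mk↔ₛ′ toSum fromSum toSum-fromSum fromSum-toSum
  where
    toSum : Maybe _ → ⊤ ⊎ _
    toSum nothing  = inj₁ tt
    toSum (just x) = inj₂ x
    fromSum : ⊤ ⊎ _ → Maybe _
    fromSum (inj₁ _) = nothing
    fromSum (inj₂ x) = just x
    toSum-fromSum : ∀ y → toSum (fromSum y) ≡ y
    toSum-fromSum (inj₁ _) = refl
    toSum-fromSum (inj₂ _) = refl
    fromSum-toSum : ∀ x → fromSum (toSum x) ≡ x
    fromSum-toSum nothing  = refl
    fromSum-toSum (just _) = refl

swap-injective : ∀ {A B : Set} {x y : A ⊎ B} → swap x ≡ swap y → x ≡ y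
swap-injective = Injection.injective (↔⇒↣ swap-↔)

injective⇒card-≤ : ∀ {A B : Set} {a b} → A ↔ Fin a → B ↔ Fin b →
                   (f : A → B) → Injective _≡_ _≡_ f → a ≤ b
injective⇒card-≤ A↔ B↔ f f-inj = injective⇒≤ (λ {i} {j} eq →
  Injection.injective (↔⇒↣ (↔-sym A↔)) (f-inj (Injection.injective (↔⇒↣ B↔) eq)))

does-true : ∀ {A : Set} (a? : Dec A) → does a? ≡ true → A
does-true (yes a) _ = a

∨-≡-true : ∀ {x y} → x ∨ y ≡ true → x ≡ true ⊎ y ≡ true
∨-≡-true {true}  _  = inj₁ refl
∨-≡-true {false} xy = inj₂ xy

∨-trueˡ : ∀ {x y} → x ≡ true → x ∨ y ≡ true
∨-trueˡ refl = refl

×Bool-↔Fin : ∀ {A : Set} {a} → A ↔ Fin a → (A × Bool) ↔ Fin (a * 2)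
×Bool-↔Fin A↔ = ↔-sym *↔× ↔-∘ (A↔ ×-↔ ↔-sym 2↔Bool)

double-≤-suc-double : ∀ {m k} → m + m ≤ suc (k + k) → m ≤ k
double-≤-suc-double {m} {k} mm≤kk+1 = subst₂ _≤_ (sym (n≡⌊n+n/2⌋ m)) (sym (n≡⌈n+n/2⌉ k)) (⌊n/2⌋-mono mm≤kk+1)

module MatchingTheory (G : Graph) where
  open Graph G using (n; adj; irrefl)

  adj-sym : ∀ {u v} → adj u v ≡ true → adj v u ≡ true
  adj-sym {u} {v} = subst (_≡ true) (Graph.sym G u v)

  adj⇒≢ : ∀ {u v} → adj u v ≡ true → u ≢ v
  adj⇒≢ uv refl = irrefl _ uv

  infix 4 _∈ᵉ_
  _∈ᵉ_ : Fin n → Pair G → Set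
  v ∈ᵉ e = v ≡ proj₁ e ⊎ v ≡ proj₂ e

  _∈ᵉ?_ : ∀ v e → Dec (v ∈ᵉ e)
  v ∈ᵉ? e = (v ≟ proj₁ e) ⊎-dec (v ≟ proj₂ e)

  Saturates : List (Pair G) → Fin n → Set
  Saturates M v = Any (v ∈ᵉ_) M

  IsVertexCover : (Fin n → Set) → Set
  IsVertexCover X = ∀ u v → adj u v ≡ true → X u ⊎ X v

  HasLeaf : Fin n → Set
  HasLeaf v = ∃[ ℓ ] adj v ℓ ≡ true × (∀ w → adj ℓ w ≡ true → w ≡ v)

  disjoint-sym : Symmetric (Disjoint G)
  disjoint-sym (a≢c , a≢d , b≢c , b≢d) = a≢c ∘ sym , b≢c ∘ sym , a≢d ∘ sym , b≢d ∘ sym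

  disjoint⇒¬common : ∀ {e f v} → Disjoint G e f → v ∈ᵉ e → v ∈ᵉ f → ⊥
  disjoint⇒¬common (a≢c , _ , _ , _) (inj₁ v≡a) (inj₁ v≡c) = a≢c (trans (sym v≡a) v≡c)
  disjoint⇒¬common (_ , a≢d , _ , _) (inj₁ v≡a) (inj₂ v≡d) = a≢d (trans (sym v≡a) v≡d)
  disjoint⇒¬common (_ , _ , b≢c , _) (inj₂ v≡b) (inj₁ v≡c) = b≢c (trans (sym v≡b) v≡c)
  disjoint⇒¬common (_ , _ , _ , b≢d) (inj₂ v≡b) (inj₂ v≡d) = b≢d (trans (sym v≡b) v≡d)

  threeDisjoint-sym : Symmetric (ThreeDisjoint G)
  threeDisjoint-sym (e#f , no-bridge) = disjoint-sym e#f , λ g g-edge (g~f , g~e) → no-bridge g g-edge (g~e , g~f)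

  nonadjacent⇒threeDisjoint : ∀ {e f} → Disjoint G e f →
                              (∀ {u v} → u ∈ᵉ e → v ∈ᵉ f → ¬ adj u v ≡ true) → ThreeDisjoint G e f
  nonadjacent⇒threeDisjoint {e} {f} e#f nonadjacent = e#f , bridge
    where
      bridge : ∀ g → IsEdge G g → ¬ (Meets G g e × Meets G g f)
      bridge (x , y) xy (inj₁ x∈e , inj₁ x∈f) = disjoint⇒¬common e#f x∈e x∈f
      bridge (x , y) xy (inj₂ y∈e , inj₂ y∈f) = disjoint⇒¬common e#f y∈e y∈f
      bridge (x , y) xy (inj₁ x∈e , inj₂ y∈f) = nonadjacent x∈e y∈f xy
      bridge (x , y) xy (inj₂ y∈e , inj₁ x∈f) = nonadjacent y∈e x∈f (adj-sym xy)

  sameEdge-refl : ∀ {e} → SameEdge G e e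
  sameEdge-refl = inj₁ (refl , refl)

  sameEdge-sym : Symmetric (SameEdge G)
  sameEdge-sym (inj₁ (a≡c , b≡d)) = inj₁ (sym a≡c , sym b≡d)
  sameEdge-sym (inj₂ (a≡d , b≡c)) = inj₂ (sym b≡c , sym a≡d)

  sameEdge-trans : ∀ {e f g} → SameEdge G e f → SameEdge G f g → SameEdge G e g
  sameEdge-trans (inj₁ (p , q)) (inj₁ (r , s)) = inj₁ (trans p r , trans q s)
  sameEdge-trans (inj₁ (p , q)) (inj₂ (r , s)) = inj₂ (trans p r , trans q s)
  sameEdge-trans (inj₂ (p , q)) (inj₁ (r , s)) = inj₂ (trans p s , trans q r)
  sameEdge-trans (inj₂ (p , q)) (inj₂ (r , s)) = inj₁ (trans p s , trans q r)

  ∈ᵉ-resp-sameEdge : ∀ {v e f} → SameEdge G e f → v ∈ᵉ e → v ∈ᵉ f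
  ∈ᵉ-resp-sameEdge (inj₁ (a≡c , _)) (inj₁ v≡a) = inj₁ (trans v≡a a≡c)
  ∈ᵉ-resp-sameEdge (inj₁ (_ , b≡d)) (inj₂ v≡b) = inj₂ (trans v≡b b≡d)
  ∈ᵉ-resp-sameEdge (inj₂ (a≡d , _)) (inj₁ v≡a) = inj₂ (trans v≡a a≡d)
  ∈ᵉ-resp-sameEdge (inj₂ (_ , b≡c)) (inj₂ v≡b) = inj₁ (trans v≡b b≡c)

  isEdge-resp-sameEdge : ∀ {e f} → SameEdge G e f → IsEdge G f → IsEdge G e
  isEdge-resp-sameEdge (inj₁ (refl , refl)) f-edge = f-edge
  isEdge-resp-sameEdge (inj₂ (refl , refl)) f-edge = adj-sym f-edge

  ∈E-resp-sameEdge : ∀ {e f M} → SameEdge G e f → _∈E_ G f M → _∈E_ G e M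
  ∈E-resp-sameEdge e≈f = Any.map (sameEdge-trans e≈f)

  saturating-edge : ∀ {M v} → Saturates M v → ∃[ e ] _∈E_ G e M × v ∈ᵉ e
  saturating-edge v∈M with find v∈M
  ... | e , e∈M , v∈e = e , Any.map (λ { refl → sameEdge-refl }) e∈M , v∈e

  matching-sharing-vertex : ∀ {M e f v} → AllPairs (Disjoint G) M →
                            _∈E_ G e M → _∈E_ G f M → v ∈ᵉ e → v ∈ᵉ f → SameEdge G e f
  matching-sharing-vertex (_ ∷ _) (here e≈g) (here f≈g) _ _ = sameEdge-trans e≈g (sameEdge-sym f≈g)
  matching-sharing-vertex (g#M ∷ _) (here e≈g) (there f∈M) v∈e v∈f
    with g#h , f≈h ← All.lookupAny g#M f∈M
    = ⊥-elim (disjoint⇒¬common g#h (∈ᵉ-resp-sameEdge e≈g v∈e) (∈ᵉ-resp-sameEdge f≈h v∈f))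
  matching-sharing-vertex (g#M ∷ _) (there e∈M) (here f≈g) v∈e v∈f
    with g#h , e≈h ← All.lookupAny g#M e∈M
    = ⊥-elim (disjoint⇒¬common g#h (∈ᵉ-resp-sameEdge f≈g v∈f) (∈ᵉ-resp-sameEdge e≈h v∈e))
  matching-sharing-vertex (_ ∷ disjoint) (there e∈M) (there f∈M) v∈e v∈f =
    matching-sharing-vertex disjoint e∈M f∈M v∈e v∈f

  maximal⇒vertexCover : ∀ {M} → IsMaximalMatching G M → IsVertexCover (Saturates M)
  maximal⇒vertexCover {M} ((edges , disjoint) , maximal) u v uv
    with any? (u ∈ᵉ?_) M | any? (v ∈ᵉ?_) M
  ... | yes u∈M | _       = inj₁ u∈M
  ... | no _    | yes v∈M = inj₂ v∈M
  ... | no u∉M  | no v∉M  = ⊥-elim (u∉M (Any.map (λ uv≈e → ∈ᵉ-resp-sameEdge uv≈e (inj₁ refl)) uv∈M))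
    where
      apart : ∀ {e} → ¬ u ∈ᵉ e → ¬ v ∈ᵉ e → Disjoint G (u , v) e
      apart u∉e v∉e = u∉e ∘ inj₁ , u∉e ∘ inj₂ , v∉e ∘ inj₁ , v∉e ∘ inj₂

      extension : IsMatching G ((u , v) ∷ M)
      extension = uv ∷ edges
                , All.zipWith (λ (u∉e , v∉e) → apart u∉e v∉e) (¬Any⇒All¬ M u∉M , ¬Any⇒All¬ M v∉M) ∷ disjoint

      uv∈M : _∈E_ G (u , v) M
      uv∈M = maximal _ extension (λ _ → there) (u , v) (here sameEdge-refl)

  vertexCover⇒maximal : ∀ {M} → IsMatching G M → IsVertexCover (Saturates M) → IsMaximalMatching G M
  vertexCover⇒maximal {M} matching cover = matching , extension⊆M
    where
      extension⊆M : ∀ M' → IsMatching G M' → (∀ e → _∈E_ G e M → _∈E_ G e M') →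
                    ∀ e → _∈E_ G e M' → _∈E_ G e M
      extension⊆M M' (edges' , disjoint') M⊆M' e e∈M' = [ via (inj₁ refl) , via (inj₂ refl) ] (cover _ _ e-edge)
        where
          e-edge : IsEdge G e
          e-edge with f-edge , e≈f ← All.lookupAny edges' e∈M' = isEdge-resp-sameEdge e≈f f-edge

          via : ∀ {v} → v ∈ᵉ e → Saturates M v → _∈E_ G e M
          via v∈e v∈M with f , f∈M , v∈f ← saturating-edge v∈M =
            ∈E-resp-sameEdge (matching-sharing-vertex disjoint' e∈M' (M⊆M' f f∈M) v∈e v∈f) f∈M

  vertexCover⇒saturates-leafOwner : ∀ {M v} → All (IsEdge G) M → IsVertexCover (Saturates M) →
                                     HasLeaf v → Saturates M v
  vertexCover⇒saturates-leafOwner {M} {v} edges cover (ℓ , vℓ , only-v) =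
    [ id , transfer edges ] (cover v ℓ vℓ)
    where
      transfer : ∀ {M} → All (IsEdge G) M → Saturates M ℓ → Saturates M v
      transfer (e-edge ∷ _) (here (inj₁ refl)) = here (inj₂ (sym (only-v _ e-edge)))
      transfer (e-edge ∷ _) (here (inj₂ refl)) = here (inj₁ (sym (only-v _ (adj-sym e-edge))))
      transfer (_ ∷ edges) (there ℓ∈M) = there (transfer edges ℓ∈M)

  module Endpoints {M : List (Pair G)} (matching : IsMatching G M) where
    Slot : Set
    Slot = Fin (length M) ⊎ Fin (length M)

    edgeAt : Slot → Pair G
    edgeAt s = lookup M (reduce s)

    endpoint : Slot → Fin n
    endpoint (inj₁ i) = proj₁ (lookup M i)
    endpoint (inj₂ i) = proj₂ (lookup M i)

    endpoint∈edgeAt : ∀ s → endpoint s ∈ᵉ edgeAt s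
    endpoint∈edgeAt (inj₁ _) = inj₁ refl
    endpoint∈edgeAt (inj₂ _) = inj₂ refl

    edgeAt-isEdge : ∀ s → IsEdge G (edgeAt s)
    edgeAt-isEdge s = All.lookup (proj₁ matching) (∈-lookup (reduce s))

    endpoint-injective : Injective _≡_ _≡_ endpoint
    endpoint-injective {s} {t} s≡t with reduce s ≟ reduce t
    ... | no i≢j = ⊥-elim (disjoint⇒¬common (AllPairs-lookup disjoint-sym (proj₂ matching) i≢j)
                            (endpoint∈edgeAt s) (subst (_∈ᵉ edgeAt t) (sym s≡t) (endpoint∈edgeAt t)))
    ... | yes i≡j = same-edge s t i≡j s≡t
      where
        same-edge : ∀ s t → reduce s ≡ reduce t → endpoint s ≡ endpoint t → s ≡ t
        same-edge (inj₁ i) (inj₁ _) refl _   = refl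
        same-edge (inj₂ i) (inj₂ _) refl _   = refl
        same-edge (inj₁ i) (inj₂ _) refl a≡b = ⊥-elim (adj⇒≢ (edgeAt-isEdge (inj₁ i)) a≡b)
        same-edge (inj₂ i) (inj₁ _) refl b≡a = ⊥-elim (adj⇒≢ (edgeAt-isEdge (inj₁ i)) (sym b≡a))

    endpoint-swap-adj : ∀ s → adj (endpoint s) (endpoint (swap s)) ≡ true
    endpoint-swap-adj (inj₁ i) = edgeAt-isEdge (inj₁ i)
    endpoint-swap-adj (inj₂ i) = adj-sym (edgeAt-isEdge (inj₁ i))

    saturated⇒endpoint : ∀ {v} → Saturates M v → ∃[ s ] endpoint s ≡ v
    saturated⇒endpoint v∈M with lookup-index v∈M
    ... | inj₁ v≡a = inj₁ (Any.index v∈M) , sym v≡a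
    ... | inj₂ v≡b = inj₂ (Any.index v∈M) , sym v≡b

    endpoint-saturated : ∀ s → Saturates M (endpoint s)
    endpoint-saturated s = lose (∈-lookup (reduce s)) (endpoint∈edgeAt s)

    slot? : Fin n → Maybe Slot
    slot? v with any? (v ∈ᵉ?_) M
    ... | yes v∈M = just (proj₁ (saturated⇒endpoint v∈M))
    ... | no _    = nothing

    slot?-just : ∀ v {s} → slot? v ≡ just s → endpoint s ≡ v
    slot?-just v eq with any? (v ∈ᵉ?_) M
    slot?-just v refl | yes v∈M = proj₂ (saturated⇒endpoint v∈M)

    slot?-nothing : ∀ v → slot? v ≡ nothing → ¬ Saturates M v
    slot?-nothing v eq with any? (v ∈ᵉ?_) M
    slot?-nothing v () | yes _
    slot?-nothing v _  | no v∉M = v∉M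

  matching-size : ∀ {M} → IsMatching G M → length M + length M ≤ n
  matching-size matching =
    injective⇒card-≤ (↔-sym +↔⊎) ↔-refl endpoint endpoint-injective
    where open Endpoints matching

  induced-matching-size : ∀ {K : Set} {k} → K ↔ Fin k → (X : Fin n → Set) (class : Fin n → K) →
    IsVertexCover X → (∀ {u v} → X u → X v → class u ≡ class v → u ≡ v ⊎ adj u v ≡ true) →
    ∀ {M} → IsInducedMatching G M → length M ≤ k
  induced-matching-size K↔ X class cover class-clique {M} (edges , threeDisjoint) =
    injective⇒card-≤ ↔-refl K↔ (class ∘ proj₁ ∘ coveredEnd) injective
    where
      coveredEnd : ∀ i → ∃[ v ] v ∈ᵉ lookup M i × X v
      coveredEnd i with cover _ _ (All.lookup edges (∈-lookup i))
      ... | inj₁ X-a = _ , inj₁ refl , X-a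
      ... | inj₂ X-b = _ , inj₂ refl , X-b

      separated : ∀ {i j} → i ≢ j → class (proj₁ (coveredEnd i)) ≢ class (proj₁ (coveredEnd j))
      separated {i} {j} i≢j same
        with e#f , no-bridge ← AllPairs-lookup threeDisjoint-sym threeDisjoint i≢j
           | u , u∈e , X-u ← coveredEnd i | v , v∈f , X-v ← coveredEnd j
        with class-clique X-u X-v same
      ... | inj₁ refl = disjoint⇒¬common e#f u∈e v∈f
      ... | inj₂ uv   = no-bridge (u , v) uv (inj₁ u∈e , inj₂ v∈f)

      injective : Injective _≡_ _≡_ (class ∘ proj₁ ∘ coveredEnd)
      injective {i} {j} same with i ≟ j
      ... | yes i≡j = i≡j
      ... | no i≢j  = ⊥-elim (separated i≢j same)

  -- M leaves at most one vertex of T₁ unsaturated and saturates every t₂ y together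
  -- with its partner, and these partners are distinct and outside T₁ ∪ T₂; so the
  -- saturated vertices among them inject into the 2|M| endpoints of M.
  module MaximalMatchingBound {T₁ T₂ : Set} (t₁ : T₁ → Fin n) (t₂ : T₂ → Fin n)
    (t₁-injective : Injective _≡_ _≡_ t₁) (t₂-injective : Injective _≡_ _≡_ t₂)
    (t₁≢t₂ : ∀ x y → t₁ x ≢ t₂ y)
    (t₁-pairs : ∀ x x' → x ≡ x' ⊎ HasLeaf (t₁ x) ⊎ HasLeaf (t₁ x') ⊎ adj (t₁ x) (t₁ x') ≡ true)
    (t₂-hasLeaf : ∀ y → HasLeaf (t₂ y))
    (t₂-neighbours : ∀ y {w} → adj (t₂ y) w ≡ true → (∀ x → w ≢ t₁ x) × (∀ y' → w ≢ t₂ y'))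
    {M : List (Pair G)} (maximal : IsMaximalMatching G M) where
    open Endpoints (proj₁ maximal)

    cover : IsVertexCover (Saturates M)
    cover = maximal⇒vertexCover maximal

    leafOwner-saturated : ∀ {v} → HasLeaf v → Saturates M v
    leafOwner-saturated = vertexCover⇒saturates-leafOwner (proj₁ (proj₁ maximal)) cover

    unsaturated-unique : ∀ {x x'} → ¬ Saturates M (t₁ x) → ¬ Saturates M (t₁ x') → x ≡ x'
    unsaturated-unique {x} {x'} x∉M x'∉M with t₁-pairs x x'
    ... | inj₁ x≡x'               = x≡x'
    ... | inj₂ (inj₁ leaf)        = ⊥-elim (x∉M (leafOwner-saturated leaf))
    ... | inj₂ (inj₂ (inj₁ leaf)) = ⊥-elim (x'∉M (leafOwner-saturated leaf))
    ... | inj₂ (inj₂ (inj₂ xx'))  = ⊥-elim ([ x∉M , x'∉M ] (cover _ _ xx'))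

    t₂-slot : T₂ → Slot
    t₂-slot y = proj₁ (saturated⇒endpoint (leafOwner-saturated (t₂-hasLeaf y)))

    t₂-slot-endpoint : ∀ y → endpoint (t₂-slot y) ≡ t₂ y
    t₂-slot-endpoint y = proj₂ (saturated⇒endpoint (leafOwner-saturated (t₂-hasLeaf y)))

    partner : T₂ → Fin n
    partner y = endpoint (swap (t₂-slot y))

    partner-adj : ∀ y → adj (t₂ y) (partner y) ≡ true
    partner-adj y = subst (λ v → adj v (partner y) ≡ true) (t₂-slot-endpoint y)
                          (endpoint-swap-adj (t₂-slot y))

    partner-injective : Injective _≡_ _≡_ partner
    partner-injective {y} {y'} same = t₂-injective (begin
      t₂ y                  ≡⟨ t₂-slot-endpoint y ⟨
      endpoint (t₂-slot y)  ≡⟨ cong endpoint (swap-injective (endpoint-injective {swap (t₂-slot y)} {swap (t₂-slot y')} same)) ⟩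
      endpoint (t₂-slot y') ≡⟨ t₂-slot-endpoint y' ⟩
      t₂ y'                 ∎)
      where open ≡-Reasoning

    Token : Set
    Token = T₁ ⊎ (T₂ ⊎ T₂)

    vertex : Token → Fin n
    vertex (inj₁ x)        = t₁ x
    vertex (inj₂ (inj₁ y)) = t₂ y
    vertex (inj₂ (inj₂ y)) = partner y

    partner≢t₁ : ∀ y x → partner y ≢ t₁ x
    partner≢t₁ y = proj₁ (t₂-neighbours y (partner-adj y))

    partner≢t₂ : ∀ y y' → partner y ≢ t₂ y'
    partner≢t₂ y = proj₂ (t₂-neighbours y (partner-adj y))

    vertex-injective : Injective _≡_ _≡_ vertex
    vertex-injective {inj₁ x}        {inj₁ x'}        eq = cong inj₁ (t₁-injective eq)
    vertex-injective {inj₁ x}        {inj₂ (inj₁ y)}  eq = ⊥-elim (t₁≢t₂ x y eq)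
    vertex-injective {inj₁ x}        {inj₂ (inj₂ y)}  eq = ⊥-elim (partner≢t₁ y x (sym eq))
    vertex-injective {inj₂ (inj₁ y)} {inj₁ x}         eq = ⊥-elim (t₁≢t₂ x y (sym eq))
    vertex-injective {inj₂ (inj₁ y)} {inj₂ (inj₁ y')} eq = cong (inj₂ ∘ inj₁) (t₂-injective eq)
    vertex-injective {inj₂ (inj₁ y)} {inj₂ (inj₂ y')} eq = ⊥-elim (partner≢t₂ y' y (sym eq))
    vertex-injective {inj₂ (inj₂ y)} {inj₁ x}         eq = ⊥-elim (partner≢t₁ y x eq)
    vertex-injective {inj₂ (inj₂ y)} {inj₂ (inj₁ y')} eq = ⊥-elim (partner≢t₂ y y' eq)
    vertex-injective {inj₂ (inj₂ y)} {inj₂ (inj₂ y')} eq = cong (inj₂ ∘ inj₂) (partner-injective eq)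

    T₂-token-saturated : ∀ y → Saturates M (vertex (inj₂ y))
    T₂-token-saturated (inj₁ y) = leafOwner-saturated (t₂-hasLeaf y)
    T₂-token-saturated (inj₂ y) = endpoint-saturated (swap (t₂-slot y))

    unsaturated-token-unique : ∀ t t' → ¬ Saturates M (vertex t) → ¬ Saturates M (vertex t') → t ≡ t'
    unsaturated-token-unique (inj₁ x) (inj₁ x') t∉M t'∉M = cong inj₁ (unsaturated-unique t∉M t'∉M)
    unsaturated-token-unique (inj₂ y) _        t∉M _    = ⊥-elim (t∉M (T₂-token-saturated y))
    unsaturated-token-unique (inj₁ _) (inj₂ y) _   t'∉M = ⊥-elim (t'∉M (T₂-token-saturated y))

    slot?-vertex-injective : Injective _≡_ _≡_ (slot? ∘ vertex)
    slot?-vertex-injective {t} {t'} eq with slot? (vertex t) in st | slot? (vertex t') in st'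
    ... | just s  | just s' = vertex-injective (begin
      vertex t   ≡⟨ slot?-just _ st ⟨
      endpoint s ≡⟨ cong endpoint (just-injective eq) ⟩
      endpoint s' ≡⟨ slot?-just _ st' ⟩
      vertex t'  ∎)
      where open ≡-Reasoning
    ... | nothing | nothing =
      unsaturated-token-unique t t' (slot?-nothing _ st) (slot?-nothing _ st')

    maximal-matching-size : ∀ {k₁ k₂} → T₁ ↔ Fin k₁ → T₂ ↔ Fin k₂ → k₁ + (k₂ + k₂) ≤ suc (length M + length M)
    maximal-matching-size T₁↔ T₂↔ =
      injective⇒card-≤ (⊎-↔Fin T₁↔ (⊎-↔Fin T₂↔ T₂↔)) (Maybe-↔Fin (↔-sym +↔⊎)) (slot? ∘ vertex) slot?-vertex-injective

  module LabelledEdges {E : Set} {k} (E↔ : E ↔ Fin k) (edge : E → Pair G)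
    (edge-isEdge : ∀ x → IsEdge G (edge x))
    (label : Fin n → Maybe E) (label-endpoint : ∀ x {v} → v ∈ᵉ edge x → label v ≡ just x) where
    open Inverse E↔ using (to; from; strictlyInverseʳ)

    edges : List (Pair G)
    edges = tabulate (edge ∘ from)

    edges-length : length edges ≡ k
    edges-length = length-tabulate _

    edge∈edges : ∀ {P : Pair G → Set} x → P (edge x) → Any P edges
    edge∈edges {P} x p = Any.tabulate⁺ (to x) (subst (P ∘ edge) (sym (strictlyInverseʳ x)) p)

    edges-disjoint : ∀ {x y} → x ≢ y → Disjoint G (edge x) (edge y)
    edges-disjoint {x} {y} x≢y = apart (inj₁ refl) (inj₁ refl) , apart (inj₁ refl) (inj₂ refl)
                               , apart (inj₂ refl) (inj₁ refl) , apart (inj₂ refl) (inj₂ refl)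
      where
        apart : ∀ {u v} → u ∈ᵉ edge x → v ∈ᵉ edge y → u ≢ v
        apart u∈x v∈y refl = x≢y (just-injective (trans (sym (label-endpoint x u∈x)) (label-endpoint y v∈y)))

    from-≢ : ∀ {i j} → i ≢ j → from i ≢ from j
    from-≢ i≢j = i≢j ∘ Injection.injective (↔⇒↣ (↔-sym E↔))

    edges-matching : IsMatching G edges
    edges-matching = All.tabulate⁺ (edge-isEdge ∘ from) , AllPairs.tabulate⁺ (edges-disjoint ∘ from-≢)

    edges-induced : (∀ {u v x y} → adj u v ≡ true → label u ≡ just x → label v ≡ just y → x ≡ y) →
                    IsInducedMatching G edges
    edges-induced label-closed = All.tabulate⁺ (edge-isEdge ∘ from) , AllPairs.tabulate⁺ threeDisjoint
      where
        threeDisjoint : ∀ {i j} → i ≢ j → ThreeDisjoint G (edge (from i)) (edge (from j))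
        threeDisjoint {i} {j} i≢j = nonadjacent⇒threeDisjoint (edges-disjoint (from-≢ i≢j)) λ u∈ v∈ uv →
          from-≢ i≢j (label-closed uv (label-endpoint (from i) u∈) (label-endpoint (from j) v∈))

  walk-++ : ∀ {u v w} → Walk G u v → Walk G v w → Walk G u w
  walk-++ here         q = q
  walk-++ (step uv p) q = step uv (walk-++ p q)

  walk-reverse : ∀ {u v} → Walk G u v → Walk G v u
  walk-reverse here        = here
  walk-reverse (step uv p) = walk-++ (walk-reverse p) (step (adj-sym uv) here)

  connected-from-root : (r : Fin n) → (∀ u → Walk G u r) → Connected G
  connected-from-root r to-root = nonempty r , λ u v → walk-++ (to-root u) (walk-reverse (to-root v))
    where
      nonempty : Fin n → 0 < n
      nonempty zero    = s≤s z≤n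
      nonempty (suc _) = s≤s z≤n

module FiniteGraph {V : Set} {n} (V↔ : V ↔ Fin n) (E : V → V → Bool)
  (E-sym : ∀ a b → E a b ≡ E b a) (E-irrefl : ∀ a → ¬ E a a ≡ true) where
  open Inverse V↔ using (strictlyInverseˡ; strictlyInverseʳ)
  open Inverse V↔ public using (from) renaming (to to ⌜_⌝)

  graph : Graph
  graph = record { n = n ; adj = λ u v → E (from u) (from v)
                 ; sym = λ u v → E-sym (from u) (from v) ; irrefl = E-irrefl ∘ from }

  open Graph graph using (adj)
  open MatchingTheory graph

  from-⌜⌝ : ∀ a → from ⌜ a ⌝ ≡ a
  from-⌜⌝ = strictlyInverseʳ

  ⌜from⌝ : ∀ u → ⌜ from u ⌝ ≡ u
  ⌜from⌝ = strictlyInverseˡ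

  ⌜⌝-injective : Injective _≡_ _≡_ ⌜_⌝
  ⌜⌝-injective {a} {b} eq = trans (sym (from-⌜⌝ a)) (trans (cong from eq) (from-⌜⌝ b))

  from-injective : Injective _≡_ _≡_ from
  from-injective {u} {v} eq = trans (sym (⌜from⌝ u)) (trans (cong ⌜_⌝ eq) (⌜from⌝ v))

  adj-⌜⌝ : ∀ {a b} → E a b ≡ true → adj ⌜ a ⌝ ⌜ b ⌝ ≡ true
  adj-⌜⌝ {a} {b} = subst₂ (λ a' b' → E a' b' ≡ true) (sym (from-⌜⌝ a)) (sym (from-⌜⌝ b))

  adj-⌜⌝⁻ : ∀ {a v} → adj ⌜ a ⌝ v ≡ true → E a (from v) ≡ true
  adj-⌜⌝⁻ {a} {v} = subst (λ a' → E a' (from v) ≡ true) (from-⌜⌝ a)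

  HasPendant : V → Set
  HasPendant a = ∃[ ℓ ] E a ℓ ≡ true × (∀ b → E ℓ b ≡ true → b ≡ a)

  hasPendant⇒hasLeaf : ∀ {a} → HasPendant a → HasLeaf ⌜ a ⌝
  hasPendant⇒hasLeaf {a} (ℓ , aℓ , only-a) =
    ⌜ ℓ ⌝ , adj-⌜⌝ aℓ , λ w ℓw → trans (sym (⌜from⌝ w)) (cong ⌜_⌝ (only-a (from w) (adj-⌜⌝⁻ ℓw)))

  walk-⌜⌝ : ∀ {a b w} → E a b ≡ true → Walk graph ⌜ b ⌝ w → Walk graph ⌜ a ⌝ w
  walk-⌜⌝ ab = step (adj-⌜⌝ ab)

  module LabelledFamily {F : Set} {k} (F↔ : F ↔ Fin k) (edge : F → V × V)
    (edge-adj : ∀ x → E (proj₁ (edge x)) (proj₂ (edge x)) ≡ true)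
    (label : V → Maybe F)
    (label-edge : ∀ x → label (proj₁ (edge x)) ≡ just x × label (proj₂ (edge x)) ≡ just x) where

    ⌜edge⌝ : F → Pair graph
    ⌜edge⌝ x = ⌜ proj₁ (edge x) ⌝ , ⌜ proj₂ (edge x) ⌝

    label-endpoint : ∀ x {v} → v ∈ᵉ ⌜edge⌝ x → label (from v) ≡ just x
    label-endpoint x (inj₁ refl) = trans (cong label (from-⌜⌝ _)) (proj₁ (label-edge x))
    label-endpoint x (inj₂ refl) = trans (cong label (from-⌜⌝ _)) (proj₂ (label-edge x))

    open LabelledEdges F↔ ⌜edge⌝ (adj-⌜⌝ ∘ edge-adj) (label ∘ from) label-endpoint public

module Pendants {C O : Set} (_≟ᶜ_ : DecidableEquality C) (E : C → C → Bool) (owner : O → C) where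
  E⁺ : C ⊎ O → C ⊎ O → Bool
  E⁺ (inj₁ c) (inj₁ c') = E c c'
  E⁺ (inj₁ c) (inj₂ o)  = does (c ≟ᶜ owner o)
  E⁺ (inj₂ o) (inj₁ c)  = does (c ≟ᶜ owner o)
  E⁺ (inj₂ _) (inj₂ _)  = false

  E⁺-sym : (∀ c c' → E c c' ≡ E c' c) → ∀ a b → E⁺ a b ≡ E⁺ b a
  E⁺-sym E-sym (inj₁ c) (inj₁ c') = E-sym c c'
  E⁺-sym E-sym (inj₁ c) (inj₂ o)  = refl
  E⁺-sym E-sym (inj₂ o) (inj₁ c)  = refl
  E⁺-sym E-sym (inj₂ _) (inj₂ _)  = refl

  E⁺-irrefl : (∀ c → ¬ E c c ≡ true) → ∀ a → ¬ E⁺ a a ≡ true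
  E⁺-irrefl E-irrefl (inj₁ c) = E-irrefl c
  E⁺-irrefl E-irrefl (inj₂ o) ()

  owner-pendant : ∀ o → E⁺ (inj₁ (owner o)) (inj₂ o) ≡ true
  owner-pendant o = dec-true (owner o ≟ᶜ owner o) refl

  pendant-neighbour : ∀ o b → E⁺ (inj₂ o) b ≡ true → b ≡ inj₁ (owner o)
  pendant-neighbour o (inj₁ c) oc = cong inj₁ (does-true (c ≟ᶜ owner o) oc)

Realisable : ℕ → ℕ → ℕ → Set
Realisable p q r = Σ Graph (λ G → Connected G × IndMatchNumber G p × MinMatchNumber G q × MatchNumber G r)

module Construction (A H S D : ℕ) where
  Clique : Set
  Clique = (Fin A ⊎ Fin H) × Bool

  Arm : Set
  Arm = Fin D × Bool

  Core : Set
  Core = ⊤ ⊎ (Clique ⊎ (Fin S ⊎ Arm))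

  pattern hub        = inj₁ tt
  pattern clique w b = inj₂ (inj₁ (w , b))
  pattern spoke j    = inj₂ (inj₂ (inj₁ j))
  pattern arm j b    = inj₂ (inj₂ (inj₂ (j , b)))

  Owner : Set
  Owner = (Fin A × Bool) ⊎ (Fin S ⊎ Arm)

  owner : Owner → Core
  owner (inj₁ (i , b))        = clique (inj₁ i) b
  owner (inj₂ (inj₁ j))       = spoke j
  owner (inj₂ (inj₂ (j , b))) = arm j b

  _≟ᶜˡ_ : DecidableEquality Clique
  _≟ᶜˡ_ = ×.≡-dec (⊎ₚ.≡-dec _≟_ _≟_) 𝔹._≟_

  _≟ᶜ_ : DecidableEquality Core
  _≟ᶜ_ = ⊎ₚ.≡-dec ⊤._≟_ (⊎ₚ.≡-dec _≟ᶜˡ_ (⊎ₚ.≡-dec _≟_ (×.≡-dec _≟_ 𝔹._≟_)))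

  arc : Core → Core → Bool
  arc hub           (clique _ _)   = true
  arc hub           (spoke _)      = true
  arc hub           (arm _ false)  = true
  arc (clique w b)  (clique w' b') = not (does ((w , b) ≟ᶜˡ (w' , b')))
  arc (arm j false) (arm j' true)  = does (j ≟ j')
  arc _             _              = false

  coreAdj : Core → Core → Bool
  coreAdj a b = arc a b ∨ arc b a

  coreAdj-sym : ∀ a b → coreAdj a b ≡ coreAdj b a
  coreAdj-sym a b = 𝔹.∨-comm (arc a b) (arc b a)

  arc-irrefl : ∀ a → arc a a ≡ false
  arc-irrefl hub           = refl
  arc-irrefl (clique w b)  = cong not (dec-true ((w , b) ≟ᶜˡ (w , b)) refl)
  arc-irrefl (spoke _)     = refl
  arc-irrefl (arm _ false) = refl
  arc-irrefl (arm _ true)  = refl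

  coreAdj-irrefl : ∀ a → ¬ coreAdj a a ≡ true
  coreAdj-irrefl a aa with () ← trans (sym (cong (λ x → x ∨ x) (arc-irrefl a))) aa

  open Pendants _≟ᶜ_ coreAdj owner public

  Vertex : Set
  Vertex = Core ⊎ Owner

  pattern core c = inj₁ c
  pattern leaf o = inj₂ o

  Clique↔ : Clique ↔ Fin ((A + H) * 2)
  Clique↔ = ×Bool-↔Fin (⊎-↔Fin ↔-refl ↔-refl)

  Arm↔ : Arm ↔ Fin (D * 2)
  Arm↔ = ×Bool-↔Fin ↔-refl

  order : ℕ
  order = (1 + ((A + H) * 2 + (S + D * 2))) + (A * 2 + (S + D * 2))

  -- Abstract, since no proof depends on the enumeration and unfolding it stalls unification.
  abstract
    Vertex↔ : Vertex ↔ Fin order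
    Vertex↔ = ⊎-↔Fin (⊎-↔Fin (↔-sym 1↔⊤) (⊎-↔Fin Clique↔ (⊎-↔Fin ↔-refl Arm↔)))
                     (⊎-↔Fin (×Bool-↔Fin ↔-refl) (⊎-↔Fin ↔-refl Arm↔))

  open FiniteGraph Vertex↔ E⁺ (E⁺-sym coreAdj-sym) (E⁺-irrefl coreAdj-irrefl) public
  open MatchingTheory graph public

  clique-pair-adj : ∀ w → E⁺ (core (clique w false)) (core (clique w true)) ≡ true
  clique-pair-adj w = ∨-trueˡ (cong not (dec-false ((w , false) ≟ᶜˡ (w , true)) λ ()))

  arm-pair-adj : ∀ j → E⁺ (core (arm j false)) (core (arm j true)) ≡ true
  arm-pair-adj j = ∨-trueˡ (dec-true (j ≟ j) refl)

  arm-pair-adj′ : ∀ j → E⁺ (core (arm j true)) (core (arm j false)) ≡ true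
  arm-pair-adj′ j = dec-true (j ≟ j) refl

  owner-hasPendant : ∀ o → HasPendant (core (owner o))
  owner-hasPendant o = leaf o , owner-pendant o , pendant-neighbour o

  inner : Vertex → Bool
  inner (core (clique _ _)) = true
  inner (core (spoke _))    = true
  inner (core (arm _ _))    = true
  inner _                   = false

  owner-inner : ∀ o → inner (core (owner o)) ≡ true
  owner-inner (inj₁ _)        = refl
  owner-inner (inj₂ (inj₁ _)) = refl
  owner-inner (inj₂ (inj₂ _)) = refl

  arc-inner : ∀ a b → arc a b ≡ true → inner (core a) ≡ true ⊎ inner (core b) ≡ true
  arc-inner (clique _ _) _            _  = inj₁ refl
  arc-inner (spoke _)    _            _  = inj₁ refl
  arc-inner (arm _ _)    _            _  = inj₁ refl
  arc-inner hub          (clique _ _) _  = inj₂ refl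
  arc-inner hub          (spoke _)    _  = inj₂ refl
  arc-inner hub          (arm _ _)    _  = inj₂ refl
  arc-inner hub          hub          ()

  pendant-neighbour-inner : ∀ o b → E⁺ (leaf o) b ≡ true → inner b ≡ true
  pendant-neighbour-inner o b ob = subst (λ v → inner v ≡ true) (sym (pendant-neighbour o b ob)) (owner-inner o)

  inner-cover : ∀ a b → E⁺ a b ≡ true → inner a ≡ true ⊎ inner b ≡ true
  inner-cover (core a) (core b) ab = [ arc-inner a b , swap ∘ arc-inner b a ] (∨-≡-true ab)
  inner-cover (core a) (leaf o) ao = inj₁ (pendant-neighbour-inner o (core a) ao)
  inner-cover (leaf o) b        ob = inj₂ (pendant-neighbour-inner o b ob)

  spoke-neighbour-outer : ∀ j b → E⁺ (core (spoke j)) b ≡ true → inner b ≡ false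
  spoke-neighbour-outer j (core hub)           _ = refl
  spoke-neighbour-outer j (leaf _)             _ = refl
  spoke-neighbour-outer j (core (clique _ _))  ()
  spoke-neighbour-outer j (core (spoke _))     ()
  spoke-neighbour-outer j (core (arm _ false)) ()
  spoke-neighbour-outer j (core (arm _ true))  ()

  Part : Set
  Part = ⊤ ⊎ (Fin S ⊎ Fin D)

  -- The hub is sent to the clique's part; it is neither inner nor labelled below, so
  -- this value is never used.
  part : Vertex → Part
  part (core (spoke j))             = inj₂ (inj₁ j)
  part (core (arm j _))             = inj₂ (inj₂ j)
  part (leaf (inj₂ (inj₁ j)))       = inj₂ (inj₁ j)
  part (leaf (inj₂ (inj₂ (j , _)))) = inj₂ (inj₂ j)
  part _                            = inj₁ tt

  inner-part-clique : ∀ a b → inner a ≡ true → inner b ≡ true → part a ≡ part b → a ≡ b ⊎ E⁺ a b ≡ true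
  inner-part-clique (core (clique w b)) (core (clique w' b')) _ _ _ with (w , b) ≟ᶜˡ (w' , b')
  ... | yes refl = inj₁ refl
  ... | no _     = inj₂ refl
  inner-part-clique (core (spoke _))     (core (spoke _))     _ _ refl = inj₁ refl
  inner-part-clique (core (arm _ false)) (core (arm _ false)) _ _ refl = inj₁ refl
  inner-part-clique (core (arm _ true))  (core (arm _ true))  _ _ refl = inj₁ refl
  inner-part-clique (core (arm j false)) (core (arm _ true))  _ _ refl = inj₂ (arm-pair-adj j)
  inner-part-clique (core (arm j true))  (core (arm _ false)) _ _ refl = inj₂ (arm-pair-adj′ j)
  inner-part-clique (core (clique _ _)) (core (spoke _))    _ _ ()
  inner-part-clique (core (clique _ _)) (core (arm _ _))    _ _ ()
  inner-part-clique (core (spoke _))    (core (clique _ _)) _ _ ()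
  inner-part-clique (core (spoke _))    (core (arm _ _))    _ _ ()
  inner-part-clique (core (arm _ _))    (core (clique _ _)) _ _ ()
  inner-part-clique (core (arm _ _))    (core (spoke _))    _ _ ()
  inner-part-clique (core hub) _ () _ _
  inner-part-clique (leaf _)   _ () _ _
  inner-part-clique _          (core hub) _ () _
  inner-part-clique _          (leaf _)   _ () _

  Inner : Fin order → Set
  Inner u = inner (from u) ≡ true

  induced-size : ∀ {M} → IsInducedMatching graph M → length M ≤ 1 + (S + D)
  induced-size = induced-matching-size (⊎-↔Fin (↔-sym 1↔⊤) (⊎-↔Fin ↔-refl ↔-refl)) Inner (part ∘ from)
    (λ u v → inner-cover (from u) (from v))
    (λ {u} {v} u-inner v-inner same → ⊎.map₁ from-injective (inner-part-clique _ _ u-inner v-inner same))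

  ⌜⌝≢outer : ∀ {a} → inner a ≡ true → ∀ {u} → inner (from u) ≡ false → u ≢ ⌜ a ⌝
  ⌜⌝≢outer a-inner u-outer refl with () ← trans (sym u-outer) (trans (cong inner (from-⌜⌝ _)) a-inner)

  nonSpoke : Clique ⊎ Arm → Vertex
  nonSpoke (inj₁ (w , b)) = core (clique w b)
  nonSpoke (inj₂ (j , b)) = core (arm j b)

  nonSpoke-injective : Injective _≡_ _≡_ nonSpoke
  nonSpoke-injective {inj₁ _} {inj₁ _} refl = refl
  nonSpoke-injective {inj₂ _} {inj₂ _} refl = refl

  nonSpoke-inner : ∀ x → inner (nonSpoke x) ≡ true
  nonSpoke-inner (inj₁ _) = refl
  nonSpoke-inner (inj₂ _) = refl

  nonSpoke-pairs : ∀ x x' → x ≡ x' ⊎ HasPendant (nonSpoke x) ⊎ HasPendant (nonSpoke x')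
                                   ⊎ E⁺ (nonSpoke x) (nonSpoke x') ≡ true
  nonSpoke-pairs (inj₁ (inj₁ i , b)) _ = inj₂ (inj₁ (owner-hasPendant (inj₁ (i , b))))
  nonSpoke-pairs (inj₂ (j , b))      _ = inj₂ (inj₁ (owner-hasPendant (inj₂ (inj₂ (j , b)))))
  nonSpoke-pairs (inj₁ (inj₂ _ , _)) (inj₁ (inj₁ i , b)) = inj₂ (inj₂ (inj₁ (owner-hasPendant (inj₁ (i , b)))))
  nonSpoke-pairs (inj₁ (inj₂ _ , _)) (inj₂ (j , b))      = inj₂ (inj₂ (inj₁ (owner-hasPendant (inj₂ (inj₂ (j , b))))))
  nonSpoke-pairs (inj₁ (inj₂ h , b)) (inj₁ (inj₂ h' , b')) with (inj₂ h , b) ≟ᶜˡ (inj₂ h' , b')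
  ... | yes refl = inj₁ refl
  ... | no _     = inj₂ (inj₂ (inj₂ refl))

  maximal-size : ∀ {M} → IsMaximalMatching graph M → (A + H) * 2 + D * 2 + (S + S) ≤ suc (length M + length M)
  maximal-size maximal = MaximalMatchingBound.maximal-matching-size t₁ t₂
    (nonSpoke-injective ∘ ⌜⌝-injective) t₂-injective t₁≢t₂
    (λ x x' → ⊎.map₂ (⊎.map hasPendant⇒hasLeaf (⊎.map hasPendant⇒hasLeaf adj-⌜⌝)) (nonSpoke-pairs x x'))
    (λ j → hasPendant⇒hasLeaf (owner-hasPendant (inj₂ (inj₁ j))))
    spoke-neighbours maximal (⊎-↔Fin Clique↔ Arm↔) ↔-refl
    where
      t₁ : Clique ⊎ Arm → Fin order
      t₁ x = ⌜ nonSpoke x ⌝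
      t₂ : Fin S → Fin order
      t₂ j = ⌜ core (spoke j) ⌝
      t₂-injective : Injective _≡_ _≡_ t₂
      t₂-injective {j} {j'} eq with refl ← ⌜⌝-injective {core (spoke j)} {core (spoke j')} eq = refl
      t₁≢t₂ : ∀ x j → t₁ x ≢ t₂ j
      t₁≢t₂ x@(inj₁ _) j eq with () ← ⌜⌝-injective {nonSpoke x} {core (spoke j)} eq
      t₁≢t₂ x@(inj₂ _) j eq with () ← ⌜⌝-injective {nonSpoke x} {core (spoke j)} eq
      spoke-neighbours : ∀ j {w} → Graph.adj graph (t₂ j) w ≡ true → (∀ x → w ≢ t₁ x) × (∀ j' → w ≢ t₂ j')
      spoke-neighbours j {w} jw = (λ x → ⌜⌝≢outer {nonSpoke x} (nonSpoke-inner x) w-outer)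
                                , (λ j' → ⌜⌝≢outer {core (spoke j')} refl w-outer)
        where w-outer = spoke-neighbour-outer j (from w) (adj-⌜⌝⁻ {core (spoke j)} jw)

  core-to-hub : ∀ c → Walk graph ⌜ core c ⌝ ⌜ core hub ⌝
  core-to-hub hub           = here
  core-to-hub (clique _ _)  = walk-⌜⌝ refl here
  core-to-hub (spoke _)     = walk-⌜⌝ refl here
  core-to-hub (arm _ false) = walk-⌜⌝ refl here
  core-to-hub (arm j true)  = walk-⌜⌝ (arm-pair-adj′ j) (core-to-hub (arm j false))

  connected : Connected graph
  connected = connected-from-root ⌜ core hub ⌝ λ u →
    subst (λ v → Walk graph v ⌜ core hub ⌝) (⌜from⌝ u) (to-hub (from u))
    where
      to-hub : ∀ a → Walk graph ⌜ a ⌝ ⌜ core hub ⌝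
      to-hub (core c) = core-to-hub c
      to-hub (leaf o) = walk-⌜⌝ {b = core (owner o)} (owner-pendant o) (core-to-hub (owner o))

  module MinimumWitness where
    Index : Set
    Index = (Fin A ⊎ Fin H) ⊎ (Fin S ⊎ Fin D)

    edge : Index → Vertex × Vertex
    edge (inj₁ w)        = core (clique w false) , core (clique w true)
    edge (inj₂ (inj₁ j)) = core (spoke j) , leaf (inj₂ (inj₁ j))
    edge (inj₂ (inj₂ j)) = core (arm j false) , core (arm j true)

    edge-adj : ∀ x → E⁺ (proj₁ (edge x)) (proj₂ (edge x)) ≡ true
    edge-adj (inj₁ w)        = clique-pair-adj w
    edge-adj (inj₂ (inj₁ j)) = owner-pendant (inj₂ (inj₁ j))
    edge-adj (inj₂ (inj₂ j)) = arm-pair-adj j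

    label : Vertex → Maybe Index
    label (core (clique w _))    = just (inj₁ w)
    label (core (spoke j))       = just (inj₂ (inj₁ j))
    label (leaf (inj₂ (inj₁ j))) = just (inj₂ (inj₁ j))
    label (core (arm j _))       = just (inj₂ (inj₂ j))
    label _                      = nothing

    label-edge : ∀ x → label (proj₁ (edge x)) ≡ just x × label (proj₂ (edge x)) ≡ just x
    label-edge (inj₁ _)        = refl , refl
    label-edge (inj₂ (inj₁ _)) = refl , refl
    label-edge (inj₂ (inj₂ _)) = refl , refl

    open LabelledFamily (⊎-↔Fin (⊎-↔Fin ↔-refl ↔-refl) (⊎-↔Fin ↔-refl ↔-refl)) edge edge-adj label label-edge public

    inner-saturated : ∀ a → inner a ≡ true → Saturates edges ⌜ a ⌝
    inner-saturated (core (clique w false)) _ = edge∈edges (inj₁ w) (inj₁ refl)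
    inner-saturated (core (clique w true))  _ = edge∈edges (inj₁ w) (inj₂ refl)
    inner-saturated (core (spoke j))        _ = edge∈edges (inj₂ (inj₁ j)) (inj₁ refl)
    inner-saturated (core (arm j false))    _ = edge∈edges (inj₂ (inj₂ j)) (inj₁ refl)
    inner-saturated (core (arm j true))     _ = edge∈edges (inj₂ (inj₂ j)) (inj₂ refl)

    maximal : IsMaximalMatching graph edges
    maximal = vertexCover⇒maximal edges-matching λ u v uv →
      ⊎.map (saturated u) (saturated v) (inner-cover (from u) (from v) uv)
      where
        saturated : ∀ u → Inner u → Saturates edges u
        saturated u u-inner = subst (Saturates edges) (⌜from⌝ u) (inner-saturated (from u) u-inner)

  module MaximumWitness where
    Index : Set
    Index = Owner ⊎ Fin H

    edge : Index → Vertex × Vertex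
    edge (inj₁ o) = core (owner o) , leaf o
    edge (inj₂ h) = core (clique (inj₂ h) false) , core (clique (inj₂ h) true)

    edge-adj : ∀ x → E⁺ (proj₁ (edge x)) (proj₂ (edge x)) ≡ true
    edge-adj (inj₁ o) = owner-pendant o
    edge-adj (inj₂ h) = clique-pair-adj (inj₂ h)

    label : Vertex → Maybe Index
    label (core hub)                 = nothing
    label (core (clique (inj₁ i) b)) = just (inj₁ (inj₁ (i , b)))
    label (core (clique (inj₂ h) _)) = just (inj₂ h)
    label (core (spoke j))           = just (inj₁ (inj₂ (inj₁ j)))
    label (core (arm j b))           = just (inj₁ (inj₂ (inj₂ (j , b))))
    label (leaf o)                   = just (inj₁ o)

    label-edge : ∀ x → label (proj₁ (edge x)) ≡ just x × label (proj₂ (edge x)) ≡ just x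
    label-edge (inj₁ (inj₁ _))        = refl , refl
    label-edge (inj₁ (inj₂ (inj₁ _))) = refl , refl
    label-edge (inj₁ (inj₂ (inj₂ _))) = refl , refl
    label-edge (inj₂ _)               = refl , refl

    open LabelledFamily (⊎-↔Fin (⊎-↔Fin (×Bool-↔Fin ↔-refl) (⊎-↔Fin ↔-refl Arm↔)) ↔-refl)
                        edge edge-adj label label-edge public

  module InducedWitness (w₀ : Fin A ⊎ Fin H) where
    edge : Part → Vertex × Vertex
    edge (inj₁ _)        = core (clique w₀ false) , core (clique w₀ true)
    edge (inj₂ (inj₁ j)) = core (spoke j) , leaf (inj₂ (inj₁ j))
    edge (inj₂ (inj₂ j)) = core (arm j false) , core (arm j true)

    edge-adj : ∀ x → E⁺ (proj₁ (edge x)) (proj₂ (edge x)) ≡ true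
    edge-adj (inj₁ _)        = clique-pair-adj w₀
    edge-adj (inj₂ (inj₁ j)) = owner-pendant (inj₂ (inj₁ j))
    edge-adj (inj₂ (inj₂ j)) = arm-pair-adj j

    label : Vertex → Maybe Part
    label (core hub) = nothing
    label v          = just (part v)

    label-edge : ∀ x → label (proj₁ (edge x)) ≡ just x × label (proj₂ (edge x)) ≡ just x
    label-edge (inj₁ tt)       = refl , refl
    label-edge (inj₂ (inj₁ _)) = refl , refl
    label-edge (inj₂ (inj₂ _)) = refl , refl

    open LabelledFamily (⊎-↔Fin (↔-sym 1↔⊤) (⊎-↔Fin ↔-refl ↔-refl)) edge edge-adj label label-edge public

    arc-part : ∀ c b → arc (inj₂ c) b ≡ true → part (core (inj₂ c)) ≡ part (core b)
    arc-part (inj₁ _)                  (clique _ _) _   = refl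
    arc-part (inj₂ (inj₂ (j , false))) (arm j' true) jj' = cong (inj₂ ∘ inj₂) (does-true (j ≟ j') jj')

    owner-label : ∀ o → label (core (owner o)) ≡ label (leaf o)
    owner-label (inj₁ _)        = refl
    owner-label (inj₂ (inj₁ _)) = refl
    owner-label (inj₂ (inj₂ _)) = refl

    -- Away from the hub the graph falls apart into the parts.
    label-closed : ∀ {a b x y} → E⁺ a b ≡ true → label a ≡ just x → label b ≡ just y → x ≡ y
    label-closed {leaf o} {b} ob ℓo ℓb = just-injective (begin
      just _                 ≡⟨ ℓo ⟨
      label (leaf o)         ≡⟨ owner-label o ⟨
      label (core (owner o)) ≡⟨ cong label (pendant-neighbour o b ob) ⟨
      label b                ≡⟨ ℓb ⟩
      just _                 ∎)
      where open ≡-Reasoning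
    label-closed {core a} {leaf o} ao ℓa ℓo = sym (label-closed {leaf o} ao ℓo ℓa)
    label-closed {core (inj₂ c)} {core (inj₂ c')} cc' refl refl =
      [ arc-part c (inj₂ c') , sym ∘ arc-part c' (inj₂ c) ] (∨-≡-true cc')

    induced : IsInducedMatching graph edges
    induced = edges-induced (λ {u} {v} → label-closed {from u} {from v})

  realisation : (Fin A ⊎ Fin H) → Realisable (1 + (S + D)) ((A + H) + (S + D)) (A * 2 + (S + D * 2) + H)
  realisation w₀ =
    graph , connected
    , ((I.edges , I.induced , I.edges-length) , λ _ → induced-size)
    , ((Min.edges , Min.maximal , Min.edges-length) , min-lower-bound)
    , ((Max.edges , Max.edges-matching , Max.edges-length) , max-upper-bound)
    where
      module I = InducedWitness w₀
      module Min = MinimumWitness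
      module Max = MaximumWitness

      min-lower-bound : ∀ M → IsMaximalMatching graph M → (A + H) + (S + D) ≤ length M
      min-lower-bound M maximal = double-≤-suc-double
        (subst (_≤ suc (length M + length M)) (count-nonSpokes A H S D) (maximal-size maximal))
        where
          count-nonSpokes : ∀ a h s d → (a + h) * 2 + d * 2 + (s + s) ≡ (a + h + (s + d)) + (a + h + (s + d))
          count-nonSpokes = solve-∀

      max-upper-bound : ∀ M → IsMatching graph M → length M ≤ A * 2 + (S + D * 2) + H
      max-upper-bound M matching = double-≤-suc-double
        (subst (length M + length M ≤_) (order-odd A H S D) (matching-size matching))
        where
          order-odd : ∀ a h s d → (1 + ((a + h) * 2 + (s + d * 2))) + (a * 2 + (s + d * 2))
                                ≡ suc ((a * 2 + (s + d * 2) + h) + (a * 2 + (s + d * 2) + h))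
          order-odd = solve-∀

realisable : ∀ A H S D {p q r} → Fin A ⊎ Fin H →
             p ≡ 1 + (S + D) → q ≡ (A + H) + (S + D) → r ≡ A * 2 + (S + D * 2) + H → Realisable p q r
realisable A H S D w₀ refl refl refl = Construction.realisation A H S D w₀

realisable-small-excess : ∀ a s e → Realisable (suc (a + s)) (suc (a + s) + e) (suc (a + s) + e + a)
realisable-small-excess a s e = realisable 0 (suc e) s a (inj₂ zero) (p≡ a s) (q≡ a s e) (r≡ a s e)
  where
    p≡ : ∀ a s → suc (a + s) ≡ 1 + (s + a)
    p≡ = solve-∀
    q≡ : ∀ a s e → suc (a + s) + e ≡ (0 + suc e) + (s + a)
    q≡ = solve-∀
    r≡ : ∀ a s e → suc (a + s) + e + a ≡ 0 * 2 + (s + a * 2) + suc e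
    r≡ = solve-∀

realisable-large-excess : ∀ k t h → Realisable (suc k) (suc k + t + h) (suc k + t + h + (suc k + t))
realisable-large-excess k t h = realisable (suc t) h 0 k (inj₁ zero) refl (q≡ k t h) (r≡ k t h)
  where
    q≡ : ∀ k t h → suc k + t + h ≡ (suc t + h) + (0 + k)
    q≡ = solve-∀
    r≡ : ∀ k t h → suc k + t + h + (suc k + t) ≡ suc t * 2 + (0 + k * 2) + h
    r≡ = solve-∀

excess≤ : ∀ q a → q + a ≤ 2 * q → a ≤ q
excess≤ q a q+a≤2q = +-cancelˡ-≤ q a q (subst (q + a ≤_) (cong (q +_) (+-identityʳ q)) q+a≤2q)

theorem1p3 : (p q r : ℕ) → 0 < p → p ≤ q → q ≤ r → r ≤ 2 * q →
    Σ Graph (λ G → Connected G × IndMatchNumber G p × MinMatchNumber G q × MatchNumber G r)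
theorem1p3 (suc k) q r _ p≤q q≤r r≤2q with a , refl ← m≤n⇒∃[o]m+o≡n q≤r with a ≤? k
... | yes a≤k with s , refl ← m≤n⇒∃[o]m+o≡n a≤k with e , refl ← m≤n⇒∃[o]m+o≡n p≤q =
  realisable-small-excess a s e
... | no a≰k with t , refl ← m≤n⇒∃[o]m+o≡n (≰⇒> a≰k) with h , refl ← m≤n⇒∃[o]m+o≡n (excess≤ q a r≤2q) =
  realisable-large-excess k t h
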